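{- Let $t\ge 2$ be an integer and let $\sigma$ be the morphism on $\{1,2\}$ given by $\sigma(1)=1^{t-1}2$, $\sigma(2)=1^{t-1}21$. For $t=2$ define $u_1=121$, $v=2112$, $w=1212$; for $t\ge 3$ define $u_j=1^{t-j}21^{j}$ for $j=1,\dots,t-1$, $v=21^t2$, $w=121^{t-1}2$. Then: for $t=2$: $\sigma(u_1)=u_1v$, $\sigma(v)=u_1wu_1$, $\sigma(w)=u_1vu_1$; for $t=3$: $\sigma(u_1)=u_1u_2v$, $\sigma(u_2)=u_1u_2w$, $\sigma(v)=u_1u_1wu_1$, $\sigma(w)=u_1u_2wu_1$; for $t\ge4$: $\sigma(u_1)=u_1u_2\cdots u_{t-1}v$, $\sigma(u_2)=u_1u_2\cdots u_{t-1}w$, for $j=3,\dots,t-1$: $\sigma(u_j)=u_1\cdots u_{t-j}\,u_{t-j+1}\,u_{t-j+1}\,u_{t-j+2}\cdots u_{t-2}\,w$ (where for $j=t-1$ this reads $u_1u_2u_2u_3\cdots u_{t-2}w$), $\sigma(v)=u_1u_1u_2\cdots u_{t-2}wu_1$, and $\sigma(w)=u_1u_2u_2u_3\cdots u_{t-2}wu_1$.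
   Context: $1^m$ denotes the word consisting of $m$ copies of the letter $1$; words are concatenated, and $\sigma$ is extended to words by concatenation. -}

module Defs where

open import Data.Nat using (ℕ; zero; suc; _+_; _∸_)
open import Data.List using (List; []; _∷_; _++_; replicate; concatMap; map; upTo)

data Letter : Set where
  𝟏 𝟐 : Letter

Word : Set
Word = List Letter

σ₀ : ℕ → Letter → Word
σ₀ t 𝟏 = replicate (t ∸ 1) 𝟏 ++ (𝟐 ∷ [])
σ₀ t 𝟐 = replicate (t ∸ 1) 𝟏 ++ (𝟐 ∷ 𝟏 ∷ [])

σ : ℕ → Word → Word
σ t = concatMap (σ₀ t)

u : ℕ → ℕ → Word
u t j = replicate (t ∸ j) 𝟏 ++ (𝟐 ∷ replicate j 𝟏)

v : ℕ → Word
v t = 𝟐 ∷ replicate t 𝟏 ++ (𝟐 ∷ [])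

w : ℕ → Word
w t = 𝟏 ∷ 𝟐 ∷ replicate (t ∸ 1) 𝟏 ++ (𝟐 ∷ [])

u₁-2 v-2 w-2 : Word
u₁-2 = 𝟏 ∷ 𝟐 ∷ 𝟏 ∷ []
v-2 = 𝟐 ∷ 𝟏 ∷ 𝟏 ∷ 𝟐 ∷ []
w-2 = 𝟏 ∷ 𝟐 ∷ 𝟏 ∷ 𝟐 ∷ []

-- U t a b = u_a u_{a+1} ⋯ u_b  (empty if b < a)
U : ℕ → ℕ → ℕ → Word
U t a b = concatMap (λ k → u t (a + k)) (upTo (suc b ∸ a))

-- Write t = m + 1, so σ(1) = 1^m 2 and σ(2) = 1^m 2 1. Every identity is checked by bringing
-- both sides to a normal form built from the block 1^m 2. On the left, σ(1^a 2 x) = (1^m 2)^(a+1) 1 σ(x).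
-- On the right, a run u_a ⋯ u_(a+n) telescopes to 1^(t-a) 2 (1^m 2)^n 1^(a+n): the trailing 1^k of u_k
-- and the leading 1^(m-k) of u_(k+1) merge into one block 1^m 2. The cases t = 2 and t = 3 are closed computations.
module Submission where

open import Defs
open import Data.Nat using (ℕ; zero; suc; _+_; _∸_; _≤_; s≤s; z≤n)
open import Data.Nat.Properties
  using (+-suc; +-comm; +-identityʳ; m+n∸m≡n; m+[n∸m]≡n; m≤n+m; m≤n⇒m≤o+n; n≤1+n; ≤-refl; ≤-trans; +-monoʳ-≤; m≤n⇒∃[o]m+o≡n)
open import Data.List using ([]; _∷_; _++_; replicate; concatMap; upTo; _∷ʳ_)
open import Data.List.Properties using (++-assoc; ++-identityʳ; concatMap-++; upTo-∷ʳ)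
open import Data.Product using (_×_; _,_)
open import Relation.Binary.PropositionalEquality using (_≡_; refl; sym; trans; cong; cong₂; module ≡-Reasoning)

open ≡-Reasoning

ones : ℕ → Word
ones n = replicate n 𝟏

-- blocks m n x = (1^m 2)^n x; keeping the tail x as an argument keeps every word right-nested.
blocks : ℕ → ℕ → Word → Word
blocks m zero    x = x
blocks m (suc n) x = ones m ++ 𝟐 ∷ blocks m n x

ones-++ : ∀ a b (x : Word) → ones a ++ ones b ++ x ≡ ones (a + b) ++ x
ones-++ zero    b x = refl
ones-++ (suc a) b x = cong (𝟏 ∷_) (ones-++ a b x)

ones-snoc : ∀ n (x : Word) → ones n ++ 𝟏 ∷ x ≡ 𝟏 ∷ ones n ++ x
ones-snoc zero    x = refl
ones-snoc (suc n) x = cong (𝟏 ∷_) (ones-snoc n x)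

ones-glue : ∀ {c m} (x : Word) → c ≤ m → ones c ++ ones (m ∸ c) ++ x ≡ ones m ++ x
ones-glue {c} {m} x c≤m = trans (ones-++ c (m ∸ c) x) (cong (λ k → ones k ++ x) (m+[n∸m]≡n c≤m))

ones-++-u : ∀ {c m} (x : Word) → c ≤ m → ones c ++ u (suc m) (suc c) ++ x ≡ ones m ++ 𝟐 ∷ ones (suc c) ++ x
ones-++-u {c} {m} x c≤m = begin
  ones c ++ (ones (m ∸ c) ++ 𝟐 ∷ ones (suc c)) ++ x  ≡⟨ cong (ones c ++_) (++-assoc (ones (m ∸ c)) _ x) ⟩
  ones c ++ ones (m ∸ c) ++ 𝟐 ∷ ones (suc c) ++ x    ≡⟨ ones-glue _ c≤m ⟩
  ones m ++ 𝟐 ∷ ones (suc c) ++ x                    ∎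

blocks-+ : ∀ m a b (x : Word) → blocks m (a + b) x ≡ blocks m a (blocks m b x)
blocks-+ m zero    b x = refl
blocks-+ m (suc a) b x = cong (λ y → ones m ++ 𝟐 ∷ y) (blocks-+ m a b x)

blocks-comm : ∀ m a b (x : Word) → blocks m a (blocks m b x) ≡ blocks m b (blocks m a x)
blocks-comm m a b x = begin
  blocks m a (blocks m b x)  ≡⟨ blocks-+ m a b x ⟨
  blocks m (a + b) x         ≡⟨ cong (λ k → blocks m k x) (+-comm a b) ⟩
  blocks m (b + a) x         ≡⟨ blocks-+ m b a x ⟩
  blocks m b (blocks m a x)  ∎

σ-ones : ∀ m n → σ (suc m) (ones n) ≡ blocks m n []
σ-ones m zero    = refl
σ-ones m (suc n) = trans (++-assoc (ones m) (𝟐 ∷ []) _) (cong (λ y → ones m ++ 𝟐 ∷ y) (σ-ones m n))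

σ-ones-𝟐∷ : ∀ m a (x : Word) → σ (suc m) (ones a ++ 𝟐 ∷ x) ≡ blocks m (suc a) (𝟏 ∷ σ (suc m) x)
σ-ones-𝟐∷ m zero    x = ++-assoc (ones m) (𝟐 ∷ 𝟏 ∷ []) _
σ-ones-𝟐∷ m (suc a) x = trans (++-assoc (ones m) (𝟐 ∷ []) _) (cong (λ y → ones m ++ 𝟐 ∷ y) (σ-ones-𝟐∷ m a x))

σ-u : ∀ m j → σ (suc m) (u (suc m) j) ≡ blocks m (suc (suc m ∸ j)) (𝟏 ∷ blocks m j [])
σ-u m j = trans (σ-ones-𝟐∷ m (suc m ∸ j) (ones j)) (cong (λ y → blocks m (suc (suc m ∸ j)) (𝟏 ∷ y)) (σ-ones m j))

U-closed-upTo : ∀ m a n (x : Word) → a + n ≤ m →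
  concatMap (λ k → u (suc m) (a + k)) (upTo (suc n)) ++ x ≡ ones (suc m ∸ a) ++ 𝟐 ∷ blocks m n (ones (a + n) ++ x)
U-closed-upTo m a zero x _ = begin
  (u (suc m) (a + 0) ++ []) ++ x             ≡⟨ cong (_++ x) (++-identityʳ (u (suc m) (a + 0))) ⟩
  u (suc m) (a + 0) ++ x                     ≡⟨ cong (λ k → u (suc m) k ++ x) (+-identityʳ a) ⟩
  u (suc m) a ++ x                           ≡⟨ ++-assoc (ones (suc m ∸ a)) (𝟐 ∷ ones a) x ⟩
  ones (suc m ∸ a) ++ 𝟐 ∷ ones a ++ x         ≡⟨ cong (λ k → ones (suc m ∸ a) ++ 𝟐 ∷ ones k ++ x) (+-identityʳ a) ⟨
  ones (suc m ∸ a) ++ 𝟐 ∷ ones (a + 0) ++ x   ∎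
U-closed-upTo m a (suc n) x a+1+n≤m = begin
  concatMap g (upTo (suc (suc n))) ++ x
    ≡⟨ cong (λ l → concatMap g l ++ x) (upTo-∷ʳ (suc n)) ⟨
  concatMap g (upTo (suc n) ∷ʳ suc n) ++ x
    ≡⟨ cong (_++ x) (concatMap-++ g (upTo (suc n)) (suc n ∷ [])) ⟩
  (concatMap g (upTo (suc n)) ++ g (suc n) ++ []) ++ x
    ≡⟨ ++-assoc (concatMap g (upTo (suc n))) _ x ⟩
  concatMap g (upTo (suc n)) ++ (g (suc n) ++ []) ++ x
    ≡⟨ cong (λ y → concatMap g (upTo (suc n)) ++ y ++ x) (++-identityʳ (g (suc n))) ⟩
  concatMap g (upTo (suc n)) ++ g (suc n) ++ x
    ≡⟨ U-closed-upTo m a n (g (suc n) ++ x) a+n≤m ⟩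
  ones (suc m ∸ a) ++ 𝟐 ∷ blocks m n (ones (a + n) ++ g (suc n) ++ x)
    ≡⟨ cong (λ y → ones (suc m ∸ a) ++ 𝟐 ∷ blocks m n y) last-block ⟩
  ones (suc m ∸ a) ++ 𝟐 ∷ blocks m n (blocks m 1 (ones (a + suc n) ++ x))
    ≡⟨ cong (λ y → ones (suc m ∸ a) ++ 𝟐 ∷ y) (blocks-comm m n 1 _) ⟩
  ones (suc m ∸ a) ++ 𝟐 ∷ blocks m (suc n) (ones (a + suc n) ++ x)
    ∎
  where
  g : ℕ → Word
  g k = u (suc m) (a + k)
  a+n≤m : a + n ≤ m
  a+n≤m = ≤-trans (+-monoʳ-≤ a (n≤1+n n)) a+1+n≤m
  last-block : ones (a + n) ++ g (suc n) ++ x ≡ blocks m 1 (ones (a + suc n) ++ x)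
  last-block = begin
    ones (a + n) ++ u (suc m) (a + suc n) ++ x      ≡⟨ cong (λ k → ones (a + n) ++ u (suc m) k ++ x) (+-suc a n) ⟩
    ones (a + n) ++ u (suc m) (suc (a + n)) ++ x    ≡⟨ ones-++-u x a+n≤m ⟩
    ones m ++ 𝟐 ∷ ones (suc (a + n)) ++ x           ≡⟨ cong (λ k → ones m ++ 𝟐 ∷ ones k ++ x) (+-suc a n) ⟨
    ones m ++ 𝟐 ∷ ones (a + suc n) ++ x             ∎

U-closed : ∀ m a n {b} (x : Word) → a + n ≡ b → b ≤ m →
  U (suc m) a b ++ x ≡ ones (suc m ∸ a) ++ 𝟐 ∷ blocks m n (ones b ++ x)
U-closed m a n x refl a+n≤m =
  trans (cong (λ l → concatMap (λ k → u (suc m) (a + k)) (upTo l) ++ x) length≡) (U-closed-upTo m a n x a+n≤m)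
  where
  length≡ : suc (a + n) ∸ a ≡ suc n
  length≡ = trans (cong (_∸ a) (sym (+-suc a n))) (m+n∸m≡n a (suc n))

σ-u₁ : ∀ n → σ (4 + n) (u (4 + n) 1) ≡ U (4 + n) 1 (3 + n) ++ v (4 + n)
σ-u₁ n = begin
  σ (4 + n) (u (4 + n) 1)                          ≡⟨ σ-u m 1 ⟩
  blocks m (4 + n) (𝟏 ∷ blocks m 1 [])             ≡⟨ blocks-comm m (3 + n) 1 _ ⟨
  blocks m (3 + n) (ones m ++ v (4 + n))           ≡⟨ U-closed m 1 (2 + n) (v (4 + n)) refl ≤-refl ⟨
  U (4 + n) 1 (3 + n) ++ v (4 + n)                 ∎
  where
  m : ℕ
  m = 3 + n

σ-u₂ : ∀ n → σ (4 + n) (u (4 + n) 2) ≡ U (4 + n) 1 (3 + n) ++ w (4 + n)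
σ-u₂ n = begin
  σ (4 + n) (u (4 + n) 2)                         ≡⟨ σ-u m 2 ⟩
  blocks m (3 + n) (𝟏 ∷ blocks m 2 [])            ≡⟨ cong (λ y → ones m ++ 𝟐 ∷ blocks m (2 + n) y) (ones-snoc m _) ⟨
  ones m ++ 𝟐 ∷ blocks m (2 + n) (ones m ++ w (4 + n)) ≡⟨ U-closed m 1 (2 + n) (w (4 + n)) refl ≤-refl ⟨
  U (4 + n) 1 (3 + n) ++ w (4 + n)                ∎
  where
  m : ℕ
  m = 3 + n

ones-w-u₁ : ∀ k → ones k ++ w (2 + k) ++ u (2 + k) 1 ≡ blocks (suc k) 3 (𝟏 ∷ [])
ones-w-u₁ k = begin
  ones k ++ 𝟏 ∷ 𝟐 ∷ (ones (suc k) ++ 𝟐 ∷ []) ++ u (2 + k) 1   ≡⟨ ones-snoc k _ ⟩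
  𝟏 ∷ ones k ++ 𝟐 ∷ (ones (suc k) ++ 𝟐 ∷ []) ++ u (2 + k) 1   ≡⟨ cong (λ y → ones (suc k) ++ 𝟐 ∷ y) (++-assoc (ones (suc k)) (𝟐 ∷ []) _) ⟩
  blocks (suc k) 3 (𝟏 ∷ [])                                  ∎

σ-v : ∀ n → σ (4 + n) (v (4 + n)) ≡ u (4 + n) 1 ++ U (4 + n) 1 (2 + n) ++ w (4 + n) ++ u (4 + n) 1
σ-v n = begin
  σ (4 + n) (v (4 + n))
    ≡⟨ σ-ones-𝟐∷ m 0 (ones (4 + n) ++ 𝟐 ∷ []) ⟩
  blocks m 1 (𝟏 ∷ σ (4 + n) (ones (4 + n) ++ 𝟐 ∷ []))
    ≡⟨ cong (λ y → blocks m 1 (𝟏 ∷ y)) (σ-ones-𝟐∷ m (4 + n) []) ⟩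
  blocks m 1 (𝟏 ∷ blocks m 3 (blocks m (2 + n) (𝟏 ∷ [])))
    ≡⟨ cong (λ y → blocks m 1 (𝟏 ∷ y)) (blocks-comm m (2 + n) 3 _) ⟨
  blocks m 1 (𝟏 ∷ blocks m (2 + n) (blocks m 3 (𝟏 ∷ [])))
    ≡⟨ cong (λ y → blocks m 1 (𝟏 ∷ blocks m (2 + n) y)) (ones-w-u₁ (2 + n)) ⟨
  blocks m 1 (𝟏 ∷ blocks m (2 + n) (ones (2 + n) ++ w (4 + n) ++ u (4 + n) 1))
    ≡⟨ cong (λ y → blocks m 1 (𝟏 ∷ y)) (U-closed m 1 (1 + n) _ refl (n≤1+n _)) ⟨
  blocks m 1 (𝟏 ∷ U (4 + n) 1 (2 + n) ++ w (4 + n) ++ u (4 + n) 1)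
    ≡⟨ ++-assoc (ones m) (𝟐 ∷ 𝟏 ∷ []) _ ⟨
  u (4 + n) 1 ++ U (4 + n) 1 (2 + n) ++ w (4 + n) ++ u (4 + n) 1
    ∎
  where
  m : ℕ
  m = 3 + n

σ-w : ∀ n → σ (4 + n) (w (4 + n)) ≡ u (4 + n) 1 ++ u (4 + n) 2 ++ U (4 + n) 2 (2 + n) ++ w (4 + n) ++ u (4 + n) 1
σ-w n = begin
  σ (4 + n) (w (4 + n))
    ≡⟨ σ-ones-𝟐∷ m 1 (ones m ++ 𝟐 ∷ []) ⟩
  blocks m 2 (𝟏 ∷ σ (4 + n) (ones m ++ 𝟐 ∷ []))
    ≡⟨ cong (λ y → blocks m 2 (𝟏 ∷ y)) (σ-ones-𝟐∷ m m []) ⟩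
  blocks m 2 (𝟏 ∷ blocks m 3 (blocks m (1 + n) (𝟏 ∷ [])))
    ≡⟨ cong (λ y → blocks m 2 (𝟏 ∷ y)) (blocks-comm m (1 + n) 3 _) ⟨
  blocks m 2 (𝟏 ∷ blocks m (1 + n) (blocks m 3 (𝟏 ∷ [])))
    ≡⟨ cong (λ y → blocks m 2 (𝟏 ∷ blocks m (1 + n) y)) (ones-w-u₁ (2 + n)) ⟨
  blocks m 2 (𝟏 ∷ blocks m (1 + n) (ones (2 + n) ++ w (4 + n) ++ u (4 + n) 1))
    ≡⟨ cong (λ y → blocks m 2 (𝟏 ∷ 𝟏 ∷ y)) (U-closed m 2 n _ refl (n≤1+n _)) ⟨
  blocks m 2 (𝟏 ∷ 𝟏 ∷ U (4 + n) 2 (2 + n) ++ w (4 + n) ++ u (4 + n) 1)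
    ≡⟨ cong (λ y → ones m ++ 𝟐 ∷ 𝟏 ∷ y) (++-assoc (ones (2 + n)) (𝟐 ∷ 𝟏 ∷ 𝟏 ∷ []) _) ⟨
  ones m ++ 𝟐 ∷ 𝟏 ∷ u (4 + n) 2 ++ U (4 + n) 2 (2 + n) ++ w (4 + n) ++ u (4 + n) 1
    ≡⟨ ++-assoc (ones m) (𝟐 ∷ 𝟏 ∷ []) _ ⟨
  u (4 + n) 1 ++ u (4 + n) 2 ++ U (4 + n) 2 (2 + n) ++ w (4 + n) ++ u (4 + n) 1
    ∎
  where
  m : ℕ
  m = 3 + n

σ-u-middle : ∀ i d → let t = 4 + (i + d); j = 3 + i in
  σ t (u t j) ≡ U t 1 (t ∸ j) ++ u t (t ∸ j + 1) ++ U t (t ∸ j + 1) (t ∸ 2) ++ w t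
σ-u-middle i d = begin
  σ t (u t (3 + i))
    ≡⟨ σ-u m (3 + i) ⟩
  blocks m (suc (t ∸ (3 + i))) (𝟏 ∷ blocks m (3 + i) [])
    ≡⟨ cong (λ e → blocks m (suc e) (𝟏 ∷ blocks m (3 + i) [])) t∸j≡1+d ⟩
  blocks m 1 (blocks m (suc d) (𝟏 ∷ blocks m 3 (blocks m i [])))
    ≡⟨ cong (λ y → blocks m 1 (blocks m (suc d) (𝟏 ∷ blocks m 1 y))) (blocks-comm m i 2 []) ⟨
  blocks m 1 (blocks m (suc d) tail)
    ≡⟨ cong (blocks m 1) (blocks-comm m d 1 tail) ⟨
  blocks m 1 (blocks m d (blocks m 1 tail))
    ≡⟨ cong (λ y → blocks m 1 (blocks m d (blocks m 1 y))) ones-++-U ⟨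
  blocks m 1 (blocks m d (blocks m 1 (ones (2 + d) ++ U t (2 + d) (2 + (i + d)) ++ w t)))
    ≡⟨ cong (λ y → blocks m 1 (blocks m d y)) (ones-++-u _ 1+d≤m) ⟨
  blocks m 1 (blocks m d (ones (suc d) ++ u t (2 + d) ++ U t (2 + d) (2 + (i + d)) ++ w t))
    ≡⟨ U-closed m 1 d _ refl 1+d≤m ⟨
  U t 1 (suc d) ++ u t (2 + d) ++ U t (2 + d) (2 + (i + d)) ++ w t
    ≡⟨ cong₂ (λ e e′ → U t 1 e ++ u t e′ ++ U t e′ (t ∸ 2) ++ w t) t∸j≡1+d t∸j+1≡2+d ⟨
  U t 1 (t ∸ (3 + i)) ++ u t (t ∸ (3 + i) + 1) ++ U t (t ∸ (3 + i) + 1) (t ∸ 2) ++ w t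
    ∎
  where
  m t : ℕ
  m = 3 + (i + d)
  t = suc m
  1+d≤m : suc d ≤ m
  1+d≤m = s≤s (m≤n⇒m≤o+n 2 (m≤n+m d i))
  t∸j≡1+d : t ∸ (3 + i) ≡ suc d
  t∸j≡1+d = trans (cong (_∸ i) (sym (+-suc i d))) (m+n∸m≡n i (suc d))
  t∸j+1≡2+d : t ∸ (3 + i) + 1 ≡ 2 + d
  t∸j+1≡2+d = trans (cong (_+ 1) t∸j≡1+d) (+-comm (suc d) 1)
  tail : Word
  tail = 𝟏 ∷ blocks m 1 (blocks m i (blocks m 2 []))
  ones-++-U : ones (2 + d) ++ U t (2 + d) (2 + (i + d)) ++ w t ≡ tail
  ones-++-U = begin
    ones (2 + d) ++ U t (2 + d) (2 + (i + d)) ++ w t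
      ≡⟨ cong (ones (2 + d) ++_) (U-closed m (2 + d) i (w t) (cong (2 +_) (+-comm d i)) (n≤1+n _)) ⟩
    𝟏 ∷ ones (suc d) ++ ones (m ∸ suc d) ++ 𝟐 ∷ blocks m i (ones (2 + (i + d)) ++ w t)
      ≡⟨ cong (𝟏 ∷_) (ones-glue _ 1+d≤m) ⟩
    𝟏 ∷ blocks m 1 (blocks m i (ones (2 + (i + d)) ++ w t))
      ≡⟨ cong (λ y → 𝟏 ∷ blocks m 1 (blocks m i y)) (ones-snoc (2 + (i + d)) _) ⟩
    tail
      ∎

σ-u-j : ∀ n j → 3 ≤ j → j ≤ 3 + n → let t = 4 + n in
  σ t (u t j) ≡ U t 1 (t ∸ j) ++ u t (t ∸ j + 1) ++ U t (t ∸ j + 1) (t ∸ 2) ++ w t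
σ-u-j n (suc (suc (suc i))) (s≤s (s≤s (s≤s z≤n))) (s≤s (s≤s (s≤s i≤n))) with m≤n⇒∃[o]m+o≡n i≤n
... | d , refl = σ-u-middle i d

lemma1 :
    -- t = 2
    ( (σ 2 u₁-2 ≡ u₁-2 ++ v-2)
    × (σ 2 v-2 ≡ u₁-2 ++ w-2 ++ u₁-2)
    × (σ 2 w-2 ≡ u₁-2 ++ v-2 ++ u₁-2) )
    -- t = 3
    × ( (σ 3 (u 3 1) ≡ u 3 1 ++ u 3 2 ++ v 3)
      × (σ 3 (u 3 2) ≡ u 3 1 ++ u 3 2 ++ w 3)
      × (σ 3 (v 3) ≡ u 3 1 ++ u 3 1 ++ w 3 ++ u 3 1)
      × (σ 3 (w 3) ≡ u 3 1 ++ u 3 2 ++ w 3 ++ u 3 1) )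
    -- t ≥ 4
    × ( (t : ℕ) → 4 ≤ t →
        (σ t (u t 1) ≡ U t 1 (t ∸ 1) ++ v t)
        × (σ t (u t 2) ≡ U t 1 (t ∸ 1) ++ w t)
        × ((j : ℕ) → 3 ≤ j → j ≤ t ∸ 1 →
            σ t (u t j) ≡ U t 1 (t ∸ j) ++ u t (t ∸ j + 1) ++ U t (t ∸ j + 1) (t ∸ 2) ++ w t)
        × (σ t (v t) ≡ u t 1 ++ U t 1 (t ∸ 2) ++ w t ++ u t 1)
        × (σ t (w t) ≡ u t 1 ++ u t 2 ++ U t 2 (t ∸ 2) ++ w t ++ u t 1) )
lemma1 =
    (refl , refl , refl)
  , (refl , refl , refl , refl)
  , λ { (suc (suc (suc (suc n)))) (s≤s (s≤s (s≤s (s≤s z≤n)))) → σ-u₁ n , σ-u₂ n , σ-u-j n , σ-v n , σ-w n }
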